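{- Every closed triangulated surface ${\cal T}$ has exactly one root: there exists a root of ${\cal T}$, and any two roots of ${\cal T}$ coincide (up to re-labeling of vertices).
   Context: A closed triangulated surface is a finite simplicial complex whose underlying topological space is a connected compact surface without boundary. The valence of a vertex $v$ is the number of triangles containing $v$. A T-move replaces an open triangle of a triangulated surface by the open star of a new 3-valent vertex (one new vertex, three new edges, three new triangles). An inverse T-move is the reverse operation: it can be applied at a 3-valent vertex $v$ of ${\cal T}$ whose link (a triangle boundary with vertices $a,b,c$) does not already bound a triangle $abc$ of ${\cal T}$; it deletes $v$ together with its open star and adds the triangle $abc$. A root of a closed triangulated surface ${\cal T}$ is a triangulation ${\cal R}$ obtained from ${\cal T}$ by a finite (possibly empty) sequence of inverse T-moves such that no inverse T-move can be applied to ${\cal R}$. -}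

module Defs where

open import Data.Nat using (ℕ; _≡ᵇ_)
open import Data.Bool using (Bool; _∨_; not)
open import Data.List using (List; []; _∷_; length; filterᵇ)
open import Data.List.Relation.Unary.All using (All)
open import Data.List.Relation.Unary.Any using (Any)
open import Data.List.Relation.Unary.AllPairs using (AllPairs)
open import Data.Product using (Σ; ∃; ∃-syntax; _×_; _,_)
open import Data.Sum using (_⊎_)
open import Relation.Nullary using (¬_)
open import Relation.Binary.PropositionalEquality using (_≡_; _≢_)
open import Relation.Binary.Construct.Closure.ReflexiveTransitive using (Star)
open import Function.Bundles using (_↔_; Inverse; _⇔_)

-- Vertices are natural numbers.  A triangle is given by its three vertices;
-- it is regarded as the SET {x , y , z}.
record Tri : Set where
  constructor tri
  field
    x y z : ℕ
open Tri public

_∈ₜ_ : ℕ → Tri → Set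
w ∈ₜ t = (w ≡ x t) ⊎ (w ≡ y t) ⊎ (w ≡ z t)

hasV : ℕ → Tri → Bool
hasV w t = (w ≡ᵇ x t) ∨ (w ≡ᵇ y t) ∨ (w ≡ᵇ z t)

SameTri : Tri → Tri → Set
SameTri t u = ∀ w → (w ∈ₜ t → w ∈ₜ u) × (w ∈ₜ u → w ∈ₜ t)

ProperTri : Tri → Set
ProperTri t = x t ≢ y t × y t ≢ z t × x t ≢ z t

-- A (finite) pure 2-dimensional simplicial complex, presented by the list of
-- its triangles (its edges and vertices are the faces of the triangles).
Complex : Set
Complex = List Tri

TriIn : Complex → ℕ → ℕ → ℕ → Set
TriIn K a b c = a ≢ b × b ≢ c × a ≢ c × Any (λ t → a ∈ₜ t × b ∈ₜ t × c ∈ₜ t) K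

Edge : Complex → ℕ → ℕ → Set
Edge K a b = ∃[ c ] TriIn K a b c

Vertex : Complex → ℕ → Set
Vertex K a = ∃[ b ] Edge K a b

-- Closed triangulated surface: a finite simplicial complex (triangles have
-- distinct vertices, no triangle listed twice), nonempty, in which every
-- edge lies in exactly two triangles, the link of every vertex is connected
-- (hence a single cycle), and which is connected.
record ClosedSurface (K : Complex) : Set where
  field
    nonempty    : K ≢ []
    proper      : All ProperTri K
    noDup       : AllPairs (λ t u → ¬ SameTri t u) K
    edge2       : ∀ a b → Edge K a b →
                  ∃[ c ] ∃[ d ] (c ≢ d × TriIn K a b c × TriIn K a b d ×
                    (∀ e → TriIn K a b e → e ≡ c ⊎ e ≡ d))
    linkConn    : ∀ v a b → Edge K v a → Edge K v b →
                  Star (λ p q → TriIn K v p q) a b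
    connected   : ∀ a b → Vertex K a → Vertex K b → Star (Edge K) a b

valence : ℕ → Complex → ℕ
valence v K = length (filterᵇ (hasV v) K)

removeStar : ℕ → Complex → Complex
removeStar v K = filterᵇ (λ t → not (hasV v t)) K

InvT : Complex → Complex → Set
InvT K K′ = ∃[ v ] ∃[ a ] ∃[ b ] ∃[ c ]
  ( valence v K ≡ 3
  × TriIn K v a b × TriIn K v b c × TriIn K v c a
  × ¬ TriIn K a b c
  × K′ ≡ tri a b c ∷ removeStar v K )

Root : Complex → Complex → Set
Root T R = Star InvT T R × ¬ (∃[ R′ ] InvT R R′)

Iso : Complex → Complex → Set
Iso K L = Σ (ℕ ↔ ℕ) λ σ → let f = Inverse.to σ in
  ∀ a b c → (TriIn K a b c → TriIn L (f a) (f b) (f c))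
          × (TriIn L (f a) (f b) (f c) → TriIn K a b c)

-- An inverse T-move trades the three triangles around a 3-valent vertex for one, so every
-- sequence of moves terminates, and whether some move applies is decidable: roots exist.
-- Uniqueness is Newman's lemma modulo relabelling of vertices.  When every edge lies on at
-- least two triangles, a collapsible vertex never lies in the link of another one, so two
-- moves at v and w either commute, or agree up to relabelling: trivially if v = w, and via
-- the transposition of v and w if both are cones over the same triangle.  Moves transport
-- along relabellings and keep every edge on two triangles, which is all Newman's argument
-- needs.  Valence 3 is replaced by the equivalent condition that every edge at v ends in
-- the link triangle a b c.
module Submission where

open import Defs
open import Data.Bool using (true; false; T; not; T?)
open import Data.Bool.Properties using (T-∨)
open import Data.Empty using (⊥; ⊥-elim)
open import Data.Fin as Fin using (Fin; zero; suc)
open import Data.Fin.Properties using (injective⇒≤) renaming (<-cmp to <-cmpᶠ)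
open import Data.List using (List; []; _∷_; length; lookup; filterᵇ)
open import Data.List.Membership.Propositional using (_∈_; find; lose)
open import Data.List.Membership.Propositional.Properties using (∈-lookup; ∈-filter⁺; ∈-filter⁻)
open import Data.List.Relation.Unary.All as All using (All; []; _∷_)
import Data.List.Relation.Unary.All.Properties as All
open import Data.List.Relation.Unary.AllPairs using (AllPairs; []; _∷_)
import Data.List.Relation.Unary.AllPairs.Properties as AllPairs
open import Data.List.Relation.Unary.Any as Any using (Any; here; there; index; satisfied)
open import Data.List.Relation.Unary.Any.Properties using (lookup-index)
open import Data.Nat using (ℕ; suc; _≡ᵇ_; _+_; _≤_; _<_; _≟_; s≤s; s<s⁻¹)
open import Data.Nat.Induction using (<-wellFounded)
open import Data.Nat.Properties using (≡ᵇ⇒≡; ≡⇒≡ᵇ; +-suc; n≤1+n; <-irrefl; ≤-antisym)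
open import Data.Product using (∃; ∃₂; ∃-syntax; _×_; _,_; -,_; proj₁; proj₂)
open import Data.Sum as Sum using (_⊎_; inj₁; inj₂)
open import Data.Unit using (tt)
open import Function using (_∘_; flip; Injective; Equivalence; Injection; Inverse; _↔_; mk↔ₛ′)
open import Function.Properties.Inverse using (↔-refl; ↔-sym; ↔-trans; ↔⇒↣)
open import Induction.WellFounded using (Acc; acc; module Subrelation)
open import Level using (0ℓ)
open import Relation.Binary using (Rel; IsEquivalence; tri<; tri≈; tri>)
import Relation.Binary.Construct.On as On
open import Relation.Binary.Construct.Closure.ReflexiveTransitive using (Star; ε; _◅_)
open import Relation.Binary.PropositionalEquality using (_≡_; _≢_; ≢-sym; refl; sym; trans; cong; subst)
open import Relation.Binary.Rewriting using (IsNormalForm; StronglyNormalizing)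
open import Relation.Nullary using (¬_; Dec; yes; no)
open import Relation.Nullary.Decidable using (_⊎-dec_; _×-dec_; ¬?; map′)

-- Counting by injections into Fin

module _ {a ℓ} {A : Set a} {R : Rel A ℓ} where

  AllPairs-lookup : ∀ {xs} → AllPairs R xs → ∀ {i j} → i Fin.< j → R (lookup xs i) (lookup xs j)
  AllPairs-lookup (Rx ∷ _)   {zero}  {suc j} _   = All.lookup Rx (∈-lookup j)
  AllPairs-lookup (_ ∷ Rxs)  {suc i} {suc j} i<j = AllPairs-lookup Rxs (s<s⁻¹ i<j)

  length≤#classes : ∀ {m xs} → AllPairs R xs → (class : ∀ {x} → x ∈ xs → Fin m) →
    (∀ {x y} (x∈ : x ∈ xs) (y∈ : y ∈ xs) → class x∈ ≡ class y∈ → ¬ R x y) →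
    length xs ≤ m
  length≤#classes {xs = xs} related class separates = injective⇒≤ class-injective
    where
    class-injective : Injective _≡_ _≡_ (λ i → class (∈-lookup {xs = xs} i))
    class-injective {i} {j} eq with <-cmpᶠ i j
    ... | tri< i<j _ _ = ⊥-elim (separates _ _ eq (AllPairs-lookup related i<j))
    ... | tri≈ _ i≡j _ = i≡j
    ... | tri> _ _ j<i = ⊥-elim (separates _ _ (sym eq) (AllPairs-lookup related j<i))

Disjoint : ∀ {a} {A : Set a} → (A → Set) → (A → Set) → Set a
Disjoint P Q = ∀ {x} → P x → Q x → ⊥

#witnessed≤length : ∀ {a} {A : Set a} {Ps : List (A → Set)} {xs : List A} →
  AllPairs Disjoint Ps → All (λ P → Any P xs) Ps → length Ps ≤ length xs
#witnessed≤length {xs = xs} disjoint witnessed =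
  length≤#classes disjoint (λ P∈ → index (All.lookup witnessed P∈)) separates
  where
  separates : ∀ {P Q} (P∈ : P ∈ _) (Q∈ : Q ∈ _) →
    index (All.lookup witnessed P∈) ≡ index (All.lookup witnessed Q∈) → ¬ Disjoint P Q
  separates {Q = Q} P∈ Q∈ eq P∩Q=∅ =
    P∩Q=∅ (lookup-index (All.lookup witnessed P∈))
          (subst (λ i → Q (lookup xs i)) (sym eq) (lookup-index (All.lookup witnessed Q∈)))

length≤#predicates : ∀ {a ℓ} {A : Set a} {R : Rel A ℓ} {xs : List A} (Ps : List (A → Set)) →
  AllPairs R xs → All (λ P → ∀ {x y} → P x → P y → ¬ R x y) Ps → All (λ x → Any (λ P → P x) Ps) xs →
  length xs ≤ length Ps
length≤#predicates Ps related coherent covered =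
  length≤#classes related (λ x∈ → index (All.lookup covered x∈)) separates
  where
  separates : ∀ {x y} (x∈ : x ∈ _) (y∈ : y ∈ _) →
    index (All.lookup covered x∈) ≡ index (All.lookup covered y∈) → ¬ _
  separates {y = y} x∈ y∈ eq =
    All.lookup coherent (∈-lookup (index (All.lookup covered x∈)))
      (lookup-index (All.lookup covered x∈))
      (subst (λ i → lookup Ps i y) (sym eq) (lookup-index (All.lookup covered y∈)))

-- Newman's lemma modulo an equivalence

module NewmanModulo
  {A : Set} (_⟶_ : Rel A 0ℓ) {_≈_ : Rel A 0ℓ} (≈-isEquivalence : IsEquivalence _≈_)
  (Good : A → Set)
  (terminating : StronglyNormalizing _⟶_)
  (step? : ∀ x → Dec (∃ (x ⟶_)))
  (⟶-preserves-Good : ∀ {x y} → Good x → x ⟶ y → Good y)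
  (simulate : ∀ {x x′ y} → Good x → Good y → x ≈ y → x ⟶ x′ → ∃[ y′ ] (y ⟶ y′ × x′ ≈ y′))
  (locally-confluent : ∀ {x y z} → Good x → x ⟶ y → x ⟶ z →
     y ≈ z ⊎ ∃₂ λ y′ z′ → y ⟶ y′ × z ⟶ z′ × y′ ≈ z′)
  where

  open IsEquivalence ≈-isEquivalence renaming (refl to ≈-refl; sym to ≈-sym; trans to ≈-trans)

  NormalFormOf : A → A → Set
  NormalFormOf x n = Star _⟶_ x n × IsNormalForm _⟶_ n

  normalise : ∀ x → ∃ (NormalFormOf x)
  normalise x = go (terminating x)
    where
    go : ∀ {x} → Acc (flip _⟶_) x → ∃ (NormalFormOf x)
    go {x} (acc rec) with step? x
    ... | no irreducible = x , ε , irreducible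
    ... | yes (y , s) = let n , ss , nf = go (rec s) in n , s ◅ ss , nf

  simulate⋆ : ∀ {x y n} → Good x → Good y → x ≈ y → NormalFormOf x n →
    ∃[ n′ ] (NormalFormOf y n′ × n ≈ n′)
  simulate⋆ gx gy x≈y (ε , nf) =
    -, (ε , λ (_ , s) → nf (-, proj₁ (proj₂ (simulate gy gx (≈-sym x≈y) s)))) , x≈y
  simulate⋆ gx gy x≈y (s ◅ ss , nf) =
    let y′ , s′ , x′≈y′ = simulate gx gy x≈y s
        n′ , (ss′ , nf′) , n≈n′ =
          simulate⋆ (⟶-preserves-Good gx s) (⟶-preserves-Good gy s′) x′≈y′ (ss , nf)
    in n′ , (s′ ◅ ss′ , nf′) , n≈n′

  normalForm-unique : ∀ {x n n′} → Good x → NormalFormOf x n → NormalFormOf x n′ → n ≈ n′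
  normalForm-unique {x} = go (terminating x)
    where
    go : ∀ {x n n′} → Acc (flip _⟶_) x → Good x → NormalFormOf x n → NormalFormOf x n′ → n ≈ n′
    go _ _ (ε , _) (ε , _) = ≈-refl
    go _ _ (ε , nf) (s ◅ _ , _) = ⊥-elim (nf (-, s))
    go _ _ (s ◅ _ , _) (ε , nf′) = ⊥-elim (nf′ (-, s))
    go (acc rec) gx (s₁ ◅ ss₁ , nf₁) (s₂ ◅ ss₂ , nf₂)
      with gy ← ⟶-preserves-Good gx s₁ | gz ← ⟶-preserves-Good gx s₂
         | locally-confluent gx s₁ s₂
    ... | inj₁ y≈z =
      let m , nfz , n≈m = simulate⋆ gy gz y≈z (ss₁ , nf₁)
      in ≈-trans n≈m (go (rec s₂) gz nfz (ss₂ , nf₂))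
    ... | inj₂ (y′ , z′ , t₁ , t₂ , y′≈z′) =
      let m , ssm , nfm = normalise y′
          m′ , (ssm′ , nfm′) , m≈m′ =
            simulate⋆ (⟶-preserves-Good gy t₁) (⟶-preserves-Good gz t₂) y′≈z′ (ssm , nfm)
      in ≈-trans (go (rec s₁) gy (ss₁ , nf₁) (t₁ ◅ ssm , nfm))
               (≈-trans m≈m′ (go (rec s₂) gz (t₂ ◅ ssm′ , nfm′) (ss₂ , nf₂)))

Spans : Tri → ℕ → ℕ → ℕ → Set
Spans t p q r = p ∈ₜ t × q ∈ₜ t × r ∈ₜ t

Distinct₃ : ℕ → ℕ → ℕ → Set
Distinct₃ p q r = p ≢ q × q ≢ r × p ≢ r

∈ₜ-dec : ∀ w t → Dec (w ∈ₜ t)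
∈ₜ-dec w (tri p q r) = w ≟ p ⊎-dec w ≟ q ⊎-dec w ≟ r

∉ₜ : ∀ {w p q r} → w ≢ p → w ≢ q → w ≢ r → ¬ w ∈ₜ tri p q r
∉ₜ w≢p _ _ (inj₁ w≡p) = w≢p w≡p
∉ₜ _ w≢q _ (inj₂ (inj₁ w≡q)) = w≢q w≡q
∉ₜ _ _ w≢r (inj₂ (inj₂ w≡r)) = w≢r w≡r

spans-self : ∀ p q r → Spans (tri p q r) p q r
spans-self p q r = inj₁ refl , inj₂ (inj₁ refl) , inj₂ (inj₂ refl)

corner : Tri → Fin 3 → ℕ
corner t zero = x t
corner t (suc zero) = y t
corner t (suc (suc zero)) = z t

corner-of : ∀ {w t} → w ∈ₜ t → ∃[ i ] corner t i ≡ w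
corner-of (inj₁ w≡x) = zero , sym w≡x
corner-of (inj₂ (inj₁ w≡y)) = suc zero , sym w≡y
corner-of (inj₂ (inj₂ w≡z)) = suc (suc zero) , sym w≡z

distinct-vertices≤3 : ∀ {t ws} → AllPairs _≢_ ws → All (_∈ₜ t) ws → length ws ≤ 3
distinct-vertices≤3 {t} distinct ∈t =
  length≤#classes distinct (λ w∈ → proj₁ (corner-of (All.lookup ∈t w∈))) same-corner
  where
  same-corner : ∀ {p q} (p∈ : p ∈ _) (q∈ : q ∈ _) → _ → ¬ p ≢ q
  same-corner p∈ q∈ eq p≢q =
    p≢q (trans (sym (proj₂ (corner-of (All.lookup ∈t p∈))))
         (trans (cong (corner t) eq) (proj₂ (corner-of (All.lookup ∈t q∈)))))

covers : ∀ {t p q r w} → Distinct₃ p q r → Spans t p q r → w ∈ₜ t → w ∈ₜ tri p q r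
covers {_} {p} {q} {r} {w} (p≢q , q≢r , p≢r) (p∈ , q∈ , r∈) w∈ with ∈ₜ-dec w (tri p q r)
... | yes w∈pqr = w∈pqr
... | no w∉pqr = ⊥-elim (<-irrefl refl (distinct-vertices≤3 distinct (p∈ ∷ q∈ ∷ r∈ ∷ w∈ ∷ [])))
  where
  distinct : AllPairs _≢_ (p ∷ q ∷ r ∷ w ∷ [])
  distinct = (p≢q ∷ p≢r ∷ (λ p≡w → w∉pqr (inj₁ (sym p≡w))) ∷ [])
           ∷ (q≢r ∷ (λ q≡w → w∉pqr (inj₂ (inj₁ (sym q≡w)))) ∷ [])
           ∷ ((λ r≡w → w∉pqr (inj₂ (inj₂ (sym r≡w)))) ∷ [])
           ∷ [] ∷ []

spans⇒⊆ : ∀ {t p q r w} → Spans t p q r → w ∈ₜ tri p q r → w ∈ₜ t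
spans⇒⊆ (p∈ , _ , _) (inj₁ refl) = p∈
spans⇒⊆ (_ , q∈ , _) (inj₂ (inj₁ refl)) = q∈
spans⇒⊆ (_ , _ , r∈) (inj₂ (inj₂ refl)) = r∈

spans-mono : ∀ {t a b c p q r} → Spans t a b c → Spans (tri a b c) p q r → Spans t p q r
spans-mono abc (p∈ , q∈ , r∈) = spans⇒⊆ abc p∈ , spans⇒⊆ abc q∈ , spans⇒⊆ abc r∈

spans⇒SameTri : ∀ {t u p q r} → Distinct₃ p q r → Spans t p q r → Spans u p q r → SameTri t u
spans⇒SameTri d t⊇ u⊇ w = (λ w∈t → spans⇒⊆ u⊇ (covers d t⊇ w∈t)) , (λ w∈u → spans⇒⊆ t⊇ (covers d u⊇ w∈u))

spans-excludes : ∀ {t p q r w} → Distinct₃ p q r → Spans t p q r → w ≢ p → w ≢ q → w ≢ r → ¬ w ∈ₜ t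
spans-excludes d pqr w≢p w≢q w≢r w∈ = ∉ₜ w≢p w≢q w≢r (covers d pqr w∈)

Spans-dec : ∀ t p q r → Dec (Spans t p q r)
Spans-dec t p q r = ∈ₜ-dec p t ×-dec ∈ₜ-dec q t ×-dec ∈ₜ-dec r t

∈ₜ-map : ∀ (f : ℕ → ℕ) {w p q r} → w ∈ₜ tri p q r → f w ∈ₜ tri (f p) (f q) (f r)
∈ₜ-map f = Sum.map (cong f) (Sum.map (cong f) (cong f))

Distinct₃-map : ∀ {f : ℕ → ℕ} {p q r} → Injective _≡_ _≡_ f →
  Distinct₃ p q r → Distinct₃ (f p) (f q) (f r)
Distinct₃-map inj (p≢q , q≢r , p≢r) = p≢q ∘ inj , q≢r ∘ inj , p≢r ∘ inj

TriIn-distinct : ∀ {K a b c} → TriIn K a b c → Distinct₃ a b c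
TriIn-distinct (a≢b , b≢c , a≢c , _) = a≢b , b≢c , a≢c

TriIn-∈ : ∀ {K t a b c} → t ∈ K → Distinct₃ a b c → Spans t a b c → TriIn K a b c
TriIn-∈ t∈ (a≢b , b≢c , a≢c) abc = a≢b , b≢c , a≢c , lose t∈ abc

TriIn-reorder : ∀ {K a b c p q r} → TriIn K a b c → Distinct₃ p q r → Spans (tri a b c) p q r →
  TriIn K p q r
TriIn-reorder (_ , _ , _ , abc∈) (p≢q , q≢r , p≢r) pqr =
  p≢q , q≢r , p≢r , Any.map (λ abc → spans-mono abc pqr) abc∈

TriIn-rotate : ∀ {K a b c} → TriIn K a b c → TriIn K b c a
TriIn-rotate abc@(a≢b , b≢c , a≢c , _) =
  TriIn-reorder abc (b≢c , ≢-sym a≢c , ≢-sym a≢b) (inj₂ (inj₁ refl) , inj₂ (inj₂ refl) , inj₁ refl)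

TriIn-swap : ∀ {K a b c} → TriIn K a b c → TriIn K b a c
TriIn-swap abc@(a≢b , b≢c , a≢c , _) =
  TriIn-reorder abc (≢-sym a≢b , a≢c , b≢c) (inj₂ (inj₁ refl) , inj₁ refl , inj₂ (inj₂ refl))

spans-flip : ∀ {a b c p q r} → Distinct₃ a b c → Spans (tri p q r) a b c → Spans (tri a b c) p q r
spans-flip d s = covers d s (inj₁ refl) , covers d s (inj₂ (inj₁ refl)) , covers d s (inj₂ (inj₂ refl))

TriIn-transfer : ∀ {K a b c p q r} → TriIn K a b c → Distinct₃ p q r → Spans (tri p q r) a b c →
  TriIn K p q r
TriIn-transfer abc d s = TriIn-reorder abc d (spans-flip (TriIn-distinct abc) s)

-- Stars and collapses

T-not⇒¬T : ∀ {b} → T (not b) → ¬ T b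
T-not⇒¬T {true} ()

¬T⇒T-not : ∀ {b} → ¬ T b → T (not b)
¬T⇒T-not {true} ¬t = ¬t tt
¬T⇒T-not {false} _ = tt

hasV⇒∈ₜ : ∀ {w} t → T (hasV w t) → w ∈ₜ t
hasV⇒∈ₜ {w} (tri p q r) h =
  Sum.map (≡ᵇ⇒≡ w p) (Sum.map (≡ᵇ⇒≡ w q) (≡ᵇ⇒≡ w r) ∘ Equivalence.to T-∨) (Equivalence.to T-∨ h)

∈ₜ⇒hasV : ∀ {w t} → w ∈ₜ t → T (hasV w t)
∈ₜ⇒hasV {w} {tri p q r} w∈ = Equivalence.from (T-∨ {w ≡ᵇ p})
  (Sum.map (≡⇒≡ᵇ w p) (Equivalence.from (T-∨ {w ≡ᵇ q}) ∘ Sum.map (≡⇒≡ᵇ w q) (≡⇒≡ᵇ w r)) w∈)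

star : ℕ → Complex → Complex
star v = filterᵇ (hasV v)

∈-star⁺ : ∀ {v t K} → t ∈ K → v ∈ₜ t → t ∈ star v K
∈-star⁺ {v} t∈ v∈ = ∈-filter⁺ (T? ∘ hasV v) t∈ (∈ₜ⇒hasV v∈)

∈-star⁻ : ∀ {v t K} → t ∈ star v K → t ∈ K × v ∈ₜ t
∈-star⁻ {v} {t} t∈ = let t∈K , h = ∈-filter⁻ (T? ∘ hasV v) t∈ in t∈K , hasV⇒∈ₜ t h

∈-removeStar⁺ : ∀ {v t K} → t ∈ K → ¬ v ∈ₜ t → t ∈ removeStar v K
∈-removeStar⁺ {v} t∈ v∉ = ∈-filter⁺ (T? ∘ (not ∘ hasV v)) t∈ (¬T⇒T-not (v∉ ∘ hasV⇒∈ₜ _))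

∈-removeStar⁻ : ∀ {v t K} → t ∈ removeStar v K → t ∈ K × ¬ v ∈ₜ t
∈-removeStar⁻ {v} t∈ = let t∈K , h = ∈-filter⁻ (T? ∘ (not ∘ hasV v)) t∈ in t∈K , T-not⇒¬T h ∘ ∈ₜ⇒hasV

length-star+removeStar : ∀ v K → length K ≡ valence v K + length (removeStar v K)
length-star+removeStar v [] = refl
length-star+removeStar v (t ∷ K) with hasV v t
... | true = cong suc (length-star+removeStar v K)
... | false = trans (cong suc (length-star+removeStar v K)) (sym (+-suc _ _))

collapse : ℕ → ℕ → ℕ → ℕ → Complex → Complex
collapse v a b c K = tri a b c ∷ removeStar v K

collapse-shrinks : ∀ {v a b c K} → valence v K ≡ 3 → length (collapse v a b c K) < length K
collapse-shrinks {v} {K = K} val rewrite length-star+removeStar v K | val = s≤s (n≤1+n _)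

TriIn-collapse⁻ : ∀ {K v a b c p q r} → TriIn (collapse v a b c K) p q r →
  Spans (tri a b c) p q r ⊎ (TriIn K p q r × ¬ v ∈ₜ tri p q r)
TriIn-collapse⁻ (_ , _ , _ , here pqr) = inj₁ pqr
TriIn-collapse⁻ (p≢q , q≢r , p≢r , there pqr∈) =
  let t , t∈ , pqr = find pqr∈
      t∈K , v∉t = ∈-removeStar⁻ t∈
  in inj₂ (TriIn-∈ t∈K (p≢q , q≢r , p≢r) pqr , v∉t ∘ spans⇒⊆ pqr)

TriIn-collapse⁺ˡ : ∀ {K v a b c p q r} → Distinct₃ p q r → Spans (tri a b c) p q r →
  TriIn (collapse v a b c K) p q r
TriIn-collapse⁺ˡ (p≢q , q≢r , p≢r) pqr = p≢q , q≢r , p≢r , here pqr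

TriIn-collapse⁺ʳ : ∀ {K v a b c p q r} → TriIn K p q r → ¬ v ∈ₜ tri p q r →
  TriIn (collapse v a b c K) p q r
TriIn-collapse⁺ʳ pqr@(p≢q , q≢r , p≢r , pqr∈) v∉ =
  let t , t∈ , spans = find pqr∈
  in TriIn-∈ (there (∈-removeStar⁺ t∈ (v∉ ∘ covers (TriIn-distinct pqr) spans)))
             (p≢q , q≢r , p≢r) spans

-- Collapsible vertices and valence

record Boundaryless (K : Complex) : Set where
  field
    proper   : All ProperTri K
    noDup    : AllPairs (λ t u → ¬ SameTri t u) K
    opposite : ∀ {a b c} → TriIn K a b c → ∃[ d ] (d ≢ c × TriIn K a b d)

record Collapsible (K : Complex) (v a b c : ℕ) : Set where
  field
    vab      : TriIn K v a b
    vbc      : TriIn K v b c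
    vca      : TriIn K v c a
    link⊆abc : ∀ {p q} → TriIn K v p q → p ∈ₜ tri a b c
    abc∉K    : ¬ TriIn K a b c

TriIn⇒star : ∀ {K v p q} → TriIn K v p q → Any (λ t → Spans t v p q) (star v K)
TriIn⇒star (_ , _ , _ , vpq∈) = let t , t∈ , vpq = find vpq∈ in lose (∈-star⁺ t∈ (proj₁ vpq)) vpq

other-corners : ∀ {t v} → ProperTri t → v ∈ₜ t → ∃₂ λ p q → Distinct₃ v p q × Spans t v p q
other-corners (x≢y , y≢z , x≢z) (inj₁ refl) =
  -, -, (x≢y , y≢z , x≢z) , spans-self _ _ _
other-corners (x≢y , y≢z , x≢z) (inj₂ (inj₁ refl)) =
  -, -, (≢-sym x≢y , x≢z , y≢z) , (inj₂ (inj₁ refl) , inj₁ refl , inj₂ (inj₂ refl))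
other-corners (x≢y , y≢z , x≢z) (inj₂ (inj₂ refl)) =
  -, -, (≢-sym x≢z , x≢y , ≢-sym y≢z) , (inj₂ (inj₂ refl) , inj₁ refl , inj₂ (inj₁ refl))

module Sectors {K v a b c} (vab : TriIn K v a b) (vbc : TriIn K v b c) (vca : TriIn K v c a) where

  sectors : List (Tri → Set)
  sectors = (λ t → Spans t v a b) ∷ (λ t → Spans t v b c) ∷ (λ t → Spans t v c a) ∷ []

  private
    v≢a = proj₁ (TriIn-distinct vab)
    a≢b = proj₁ (proj₂ (TriIn-distinct vab))
    v≢b = proj₂ (proj₂ (TriIn-distinct vab))
    b≢c = proj₁ (proj₂ (TriIn-distinct vbc))
    v≢c = proj₂ (proj₂ (TriIn-distinct vbc))
    c≢a = proj₁ (proj₂ (TriIn-distinct vca))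

  abc-distinct : Distinct₃ a b c
  abc-distinct = a≢b , b≢c , ≢-sym c≢a

  sectors-disjoint : AllPairs Disjoint sectors
  sectors-disjoint =
    ((λ s₁ (_ , _ , c∈) → excl-c s₁ c∈) ∷ (λ s₁ (_ , c∈ , _) → excl-c s₁ c∈) ∷ [])
    ∷ ((λ s₂ (_ , _ , a∈) → spans-excludes (TriIn-distinct vbc) s₂ (≢-sym v≢a) a≢b (≢-sym c≢a) a∈) ∷ [])
    ∷ [] ∷ []
    where
    excl-c : ∀ {t} → Spans t v a b → ¬ c ∈ₜ t
    excl-c s = spans-excludes (TriIn-distinct vab) s (≢-sym v≢c) c≢a (≢-sym b≢c)

  sectors-witnessed : All (λ P → Any P (star v K)) sectors
  sectors-witnessed = TriIn⇒star vab ∷ TriIn⇒star vbc ∷ TriIn⇒star vca ∷ []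

  sectors-coherent : All (λ P → ∀ {t u} → P t → P u → ¬ ¬ SameTri t u) sectors
  sectors-coherent =
    same (TriIn-distinct vab) ∷ same (TriIn-distinct vbc) ∷ same (TriIn-distinct vca) ∷ []
    where
    same : ∀ {p q r} → Distinct₃ p q r → ∀ {t u} → Spans t p q r → Spans u p q r → ¬ ¬ SameTri t u
    same d t⊇ u⊇ ¬same = ¬same (spans⇒SameTri d t⊇ u⊇)

  3≤valence : 3 ≤ valence v K
  3≤valence = #witnessed≤length sectors-disjoint sectors-witnessed

  sector-of : ∀ {t p q} → p ∈ₜ tri a b c → q ∈ₜ tri a b c → p ≢ q → Spans t v p q →
    Any (λ P → P t) sectors
  sector-of (inj₁ refl) (inj₁ refl) p≢q _ = ⊥-elim (p≢q refl)
  sector-of (inj₁ refl) (inj₂ (inj₁ refl)) _ s = here s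
  sector-of (inj₁ refl) (inj₂ (inj₂ refl)) _ (v∈ , a∈ , c∈) = there (there (here (v∈ , c∈ , a∈)))
  sector-of (inj₂ (inj₁ refl)) (inj₁ refl) _ (v∈ , b∈ , a∈) = here (v∈ , a∈ , b∈)
  sector-of (inj₂ (inj₁ refl)) (inj₂ (inj₁ refl)) p≢q _ = ⊥-elim (p≢q refl)
  sector-of (inj₂ (inj₁ refl)) (inj₂ (inj₂ refl)) _ s = there (here s)
  sector-of (inj₂ (inj₂ refl)) (inj₁ refl) _ s = there (there (here s))
  sector-of (inj₂ (inj₂ refl)) (inj₂ (inj₁ refl)) _ (v∈ , c∈ , b∈) = there (here (v∈ , b∈ , c∈))
  sector-of (inj₂ (inj₂ refl)) (inj₂ (inj₂ refl)) p≢q _ = ⊥-elim (p≢q refl)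

  v∉abc : ¬ v ∈ₜ tri a b c
  v∉abc = ∉ₜ v≢a v≢b v≢c

  link-distinct : ∀ {p q} → p ∈ₜ tri a b c → q ∈ₜ tri a b c → p ≢ q → Distinct₃ v p q
  link-distinct p∈ q∈ p≢q =
    (λ v≡p → v∉abc (subst (_∈ₜ _) (sym v≡p) p∈)) , p≢q , (λ v≡q → v∉abc (subst (_∈ₜ _) (sym v≡q) q∈))

  link-edge : ∀ {p q} → p ∈ₜ tri a b c → q ∈ₜ tri a b c → p ≢ q → TriIn K p q v
  link-edge {p} {q} p∈ q∈ p≢q with sector-of p∈ q∈ p≢q (spans-self v p q)
  ... | here s = TriIn-rotate (TriIn-transfer vab (link-distinct p∈ q∈ p≢q) s)
  ... | there (here s) = TriIn-rotate (TriIn-transfer vbc (link-distinct p∈ q∈ p≢q) s)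
  ... | there (there (here s)) = TriIn-rotate (TriIn-transfer vca (link-distinct p∈ q∈ p≢q) s)

  third : ∀ {p q} → p ∈ₜ tri a b c → q ∈ₜ tri a b c → p ≢ q →
    ∃[ w ] (Distinct₃ p q w × Spans (tri a b c) p q w)
  third (inj₁ refl) (inj₁ refl) p≢q = ⊥-elim (p≢q refl)
  third (inj₁ refl) (inj₂ (inj₁ refl)) _ = c , (a≢b , b≢c , ≢-sym c≢a) , spans-self a b c
  third (inj₁ refl) (inj₂ (inj₂ refl)) _ =
    b , (≢-sym c≢a , ≢-sym b≢c , a≢b) , (inj₁ refl , inj₂ (inj₂ refl) , inj₂ (inj₁ refl))
  third (inj₂ (inj₁ refl)) (inj₁ refl) _ =
    c , (≢-sym a≢b , ≢-sym c≢a , b≢c) , (inj₂ (inj₁ refl) , inj₁ refl , inj₂ (inj₂ refl))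
  third (inj₂ (inj₁ refl)) (inj₂ (inj₁ refl)) p≢q = ⊥-elim (p≢q refl)
  third (inj₂ (inj₁ refl)) (inj₂ (inj₂ refl)) _ =
    a , (b≢c , c≢a , ≢-sym a≢b) , (inj₂ (inj₁ refl) , inj₂ (inj₂ refl) , inj₁ refl)
  third (inj₂ (inj₂ refl)) (inj₁ refl) _ =
    b , (c≢a , a≢b , ≢-sym b≢c) , (inj₂ (inj₂ refl) , inj₁ refl , inj₂ (inj₁ refl))
  third (inj₂ (inj₂ refl)) (inj₂ (inj₁ refl)) _ =
    a , (≢-sym b≢c , ≢-sym a≢b , c≢a) , (inj₂ (inj₂ refl) , inj₂ (inj₁ refl) , inj₁ refl)
  third (inj₂ (inj₂ refl)) (inj₂ (inj₂ refl)) p≢q = ⊥-elim (p≢q refl)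

  valence≤3 : All ProperTri K → AllPairs (λ t u → ¬ SameTri t u) K →
    (∀ {p q} → TriIn K v p q → p ∈ₜ tri a b c) → valence v K ≤ 3
  valence≤3 proper noDup link⊆abc =
    length≤#predicates sectors (AllPairs.filter⁺ (T? ∘ hasV v) noDup) sectors-coherent
      (All.tabulate classify)
    where
    classify : ∀ {t} → t ∈ star v K → Any (λ P → P t) sectors
    classify t∈ with ∈-star⁻ t∈
    ... | t∈K , v∈t with other-corners (All.lookup proper t∈K) v∈t
    ...   | p , q , d , vpq =
      let vpq∈K = TriIn-∈ t∈K d vpq
      in sector-of (link⊆abc vpq∈K) (link⊆abc (TriIn-rotate (TriIn-swap vpq∈K))) (proj₁ (proj₂ d)) vpq

valence≡3⇒link⊆abc : ∀ {K v a b c p q} → valence v K ≡ 3 →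
  TriIn K v a b → TriIn K v b c → TriIn K v c a → TriIn K v p q → p ∈ₜ tri a b c
valence≡3⇒link⊆abc {K} {v} {a} {b} {c} {p} {q} val vab vbc vca vpq with ∈ₜ-dec p (tri a b c)
... | yes p∈ = p∈
... | no p∉ = ⊥-elim (<-irrefl refl (subst (4 ≤_) val
        (#witnessed≤length (vpq-disjoint ∷ sectors-disjoint) (TriIn⇒star vpq ∷ sectors-witnessed))))
  where
  open Sectors vab vbc vca
  p≢v = ≢-sym (proj₁ (TriIn-distinct vpq))
  p≢a = p∉ ∘ inj₁
  p≢b = p∉ ∘ inj₂ ∘ inj₁
  p≢c = p∉ ∘ inj₂ ∘ inj₂
  vpq-disjoint : All (Disjoint (λ t → Spans t v p q)) sectors
  vpq-disjoint = (λ (_ , p∈ , _) s → spans-excludes (TriIn-distinct vab) s p≢v p≢a p≢b p∈)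
               ∷ (λ (_ , p∈ , _) s → spans-excludes (TriIn-distinct vbc) s p≢v p≢b p≢c p∈)
               ∷ (λ (_ , p∈ , _) s → spans-excludes (TriIn-distinct vca) s p≢v p≢c p≢a p∈)
               ∷ []

Collapsible⇒valence≡3 : ∀ {K v a b c} → Boundaryless K → Collapsible K v a b c → valence v K ≡ 3
Collapsible⇒valence≡3 bl col =
  ≤-antisym (valence≤3 (Boundaryless.proper bl) (Boundaryless.noDup bl) link⊆abc) 3≤valence
  where
  open Collapsible col
  open Sectors vab vbc vca

InvT⇒Collapsible : ∀ {K K′} → InvT K K′ →
  ∃[ v ] ∃[ a ] ∃[ b ] ∃[ c ] (Collapsible K v a b c × K′ ≡ collapse v a b c K)
InvT⇒Collapsible (v , a , b , c , val , vab , vbc , vca , abc∉K , refl) =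
  v , a , b , c , record { vab = vab ; vbc = vbc ; vca = vca
                         ; link⊆abc = valence≡3⇒link⊆abc val vab vbc vca ; abc∉K = abc∉K } , refl

Collapsible⇒InvT : ∀ {K v a b c} → Boundaryless K → Collapsible K v a b c → InvT K (collapse v a b c K)
Collapsible⇒InvT {v = v} {a} {b} {c} bl col =
  v , a , b , c , Collapsible⇒valence≡3 bl col , vab , vbc , vca , abc∉K , refl
  where open Collapsible col

Boundaryless-collapse : ∀ {K v a b c} → Boundaryless K → Collapsible K v a b c →
  Boundaryless (collapse v a b c K)
Boundaryless-collapse {K} {v} {a} {b} {c} bl col = record
  { proper   = abc-distinct ∷ All.filter⁺ (T? ∘ (not ∘ hasV v)) proper
  ; noDup    = All.tabulate abc-new ∷ AllPairs.filter⁺ (T? ∘ (not ∘ hasV v)) noDup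
  ; opposite = opposite′
  }
  where
  open Boundaryless bl
  open Collapsible col
  open Sectors vab vbc vca

  no-abc-face : ∀ {p q r} → TriIn K p q r → ¬ Spans (tri a b c) p q r
  no-abc-face pqr s = abc∉K (TriIn-transfer pqr abc-distinct s)

  abc-new : ∀ {u} → u ∈ removeStar v K → ¬ SameTri (tri a b c) u
  abc-new u∈ same = abc∉K (TriIn-∈ (proj₁ (∈-removeStar⁻ {v} u∈)) abc-distinct
    (proj₁ (same a) (inj₁ refl) , proj₁ (same b) (inj₂ (inj₁ refl)) , proj₁ (same c) (inj₂ (inj₂ refl))))

  -- An edge of a b c is completed by the triangle across it from v; an old edge whose other
  -- triangle was removed with the star of v is completed by a b c.
  opposite′ : ∀ {p q r} → TriIn (collapse v a b c K) p q r →
    ∃[ d ] (d ≢ r × TriIn (collapse v a b c K) p q d)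
  opposite′ {p} {q} {r} pqr with TriIn-collapse⁻ pqr
  ... | inj₁ s@(p∈ , q∈ , _) =
    let p≢q = proj₁ (TriIn-distinct pqr)
        v≢p , _ , v≢q = link-distinct p∈ q∈ p≢q
        d , d≢v , pqd = opposite (link-edge p∈ q∈ p≢q)
    in d , (λ d≡r → no-abc-face (subst (TriIn K p q) d≡r pqd) s) ,
       TriIn-collapse⁺ʳ pqd (∉ₜ v≢p v≢q (≢-sym d≢v))
  ... | inj₂ (pqr∈K , v∉pqr) with opposite pqr∈K
  ...   | d , d≢r , pqd with v ≟ d
  ...     | no v≢d = d , d≢r , TriIn-collapse⁺ʳ pqd (∉ₜ (v∉pqr ∘ inj₁) (v∉pqr ∘ inj₂ ∘ inj₁) v≢d)
  ...     | yes refl =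
    let w , pqw , s = third (link⊆abc (TriIn-rotate (TriIn-rotate pqd)))
                            (link⊆abc (TriIn-swap (TriIn-rotate pqd))) (proj₁ (TriIn-distinct pqr))
    in w , (λ w≡r → no-abc-face pqr∈K (subst (Spans (tri a b c) p q) w≡r s)) ,
       TriIn-collapse⁺ˡ {K} {v} pqw s

ClosedSurface⇒Boundaryless : ∀ {K} → ClosedSurface K → Boundaryless K
ClosedSurface⇒Boundaryless {K} cs = record { proper = proper ; noDup = noDup ; opposite = opposite }
  where
  open ClosedSurface cs
  opposite : ∀ {a b c} → TriIn K a b c → ∃[ d ] (d ≢ c × TriIn K a b d)
  opposite {a} {b} {c} abc with edge2 a b (c , abc)
  ... | c′ , d′ , c′≢d′ , abc′ , abd′ , _ with c ≟ c′
  ...   | yes refl = d′ , ≢-sym c′≢d′ , abd′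
  ...   | no c≢c′ = c′ , ≢-sym c≢c′ , abc′

-- Relabelling

TriIn-cong : ∀ {K a b c a′ b′ c′} → a ≡ a′ → b ≡ b′ → c ≡ c′ → TriIn K a b c → TriIn K a′ b′ c′
TriIn-cong refl refl refl abc = abc

mkIso : ∀ {K L} (σ : ℕ ↔ ℕ) → let open Inverse σ in
  (∀ {a b c} → TriIn K a b c → TriIn L (to a) (to b) (to c)) →
  (∀ {a b c} → TriIn L a b c → TriIn K (from a) (from b) (from c)) → Iso K L
mkIso σ K→L L→K = σ , λ a b c → K→L , λ abc → TriIn-cong (gf a) (gf b) (gf c) (L→K abc)
  where gf = Inverse.strictlyInverseʳ σ

Iso-sym : ∀ {K L} → Iso K L → Iso L K
Iso-sym (σ , maps) =
  mkIso (↔-sym σ) (λ abc → proj₂ (maps _ _ _) (TriIn-cong (sym (fg _)) (sym (fg _)) (sym (fg _)) abc))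
                  (proj₁ (maps _ _ _))
  where fg = Inverse.strictlyInverseˡ σ

Iso-isEquivalence : IsEquivalence Iso
Iso-isEquivalence = record
  { refl  = ↔-refl , λ _ _ _ → (λ abc → abc) , (λ abc → abc)
  ; sym   = Iso-sym
  ; trans = λ (σ , P) (τ , Q) → ↔-trans σ τ , λ a b c →
              (proj₁ (Q _ _ _) ∘ proj₁ (P a b c)) , (proj₂ (P a b c) ∘ proj₂ (Q _ _ _))
  }

Iso-pointwise : ∀ {K L} → (∀ {p q r} → TriIn K p q r → TriIn L p q r) →
  (∀ {p q r} → TriIn L p q r → TriIn K p q r) → Iso K L
Iso-pointwise = mkIso ↔-refl

TriIn-collapse-relabel : ∀ {K L v a b c v′ a′ b′ c′ p q r} {f : ℕ → ℕ} → Injective _≡_ _≡_ f →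
  (∀ {p q r} → TriIn K p q r → TriIn L (f p) (f q) (f r)) → f v ≡ v′ →
  (∀ {s} → s ∈ₜ tri a b c → f s ∈ₜ tri a′ b′ c′) →
  TriIn (collapse v a b c K) p q r → TriIn (collapse v′ a′ b′ c′ L) (f p) (f q) (f r)
TriIn-collapse-relabel {K} {L} {v} {a} {b} {c} {v′} {a′} {b′} {c′} {f = f} inj K→L refl abc→ pqr
  with TriIn-collapse⁻ {K} {v} {a} {b} {c} pqr
... | inj₁ (p∈ , q∈ , r∈) =
  TriIn-collapse⁺ˡ {L} {v′} (Distinct₃-map inj (TriIn-distinct pqr)) (abc→ p∈ , abc→ q∈ , abc→ r∈)
... | inj₂ (pqr∈K , v∉) =
  TriIn-collapse⁺ʳ {L} {v′} {a′} {b′} {c′} (K→L pqr∈K) (v∉ ∘ Sum.map inj (Sum.map inj inj))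

collapse-Iso : ∀ {K L v a b c} (iso : Iso K L) → let f = Inverse.to (proj₁ iso) in
  Iso (collapse v a b c K) (collapse (f v) (f a) (f b) (f c) L)
collapse-Iso {K} {L} {v} {a} {b} {c} iso@(σ , maps) = mkIso σ forward backward
  where
  open Inverse σ
  back : ∀ {s u} → s ≡ to u → from s ≡ u
  back refl = strictlyInverseʳ _
  forward : ∀ {p q r} → TriIn (collapse v a b c K) p q r →
    TriIn (collapse (to v) (to a) (to b) (to c) L) (to p) (to q) (to r)
  forward = TriIn-collapse-relabel {K} {L} {v} {a} {b} {c}
    (Injection.injective (↔⇒↣ σ)) (proj₁ (maps _ _ _)) refl (∈ₜ-map to)
  backward : ∀ {p q r} → TriIn (collapse (to v) (to a) (to b) (to c) L) p q r →
    TriIn (collapse v a b c K) (from p) (from q) (from r)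
  backward = TriIn-collapse-relabel {L} {K} {to v} {to a} {to b} {to c}
    (Injection.injective (↔⇒↣ (↔-sym σ))) (proj₁ (proj₂ (Iso-sym iso) _ _ _))
    (strictlyInverseʳ v) (Sum.map back (Sum.map back back))

Collapsible-Iso : ∀ {K L v a b c} (iso : Iso K L) → let f = Inverse.to (proj₁ iso) in
  Collapsible K v a b c → Collapsible L (f v) (f a) (f b) (f c)
Collapsible-Iso {v = v} (σ , maps) col = record
  { vab = K→L vab ; vbc = K→L vbc ; vca = K→L vca
  ; link⊆abc = λ {p} {q} vpq → subst (_∈ₜ _) (strictlyInverseˡ p) (∈ₜ-map to (link⊆abc
      (L→K (TriIn-cong refl (sym (strictlyInverseˡ p)) (sym (strictlyInverseˡ q)) vpq))))
  ; abc∉K = abc∉K ∘ L→K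
  }
  where
  open Inverse σ
  open Collapsible col
  K→L = λ {p q r} → proj₁ (maps p q r)
  L→K = λ {p q r} → proj₂ (maps p q r)

-- Local confluence

Collapsible-rotate : ∀ {K v a b c} → Collapsible K v a b c → Collapsible K v b c a
Collapsible-rotate col = record
  { vab = vbc ; vbc = vca ; vca = vab
  ; link⊆abc = λ vpq → rotate (link⊆abc vpq)
  ; abc∉K = abc∉K ∘ TriIn-rotate ∘ TriIn-rotate
  }
  where
  open Collapsible col
  rotate : ∀ {p} → p ∈ₜ tri _ _ _ → p ∈ₜ tri _ _ _
  rotate (inj₁ p≡a) = inj₂ (inj₂ p≡a)
  rotate (inj₂ (inj₁ p≡b)) = inj₁ p≡b
  rotate (inj₂ (inj₂ p≡c)) = inj₂ (inj₁ p≡c)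

-- The triangle across the edge a b from v is forced to be a b c, as the link of a is {v , b , c}.
link-vertex-not-collapsible : ∀ {K v a b c x y z} → Boundaryless K → Collapsible K v a b c →
  ¬ Collapsible K a x y z
link-vertex-not-collapsible {v = v} {b = b} {c} bl colv cola
  with Boundaryless.opposite bl (TriIn-rotate (Collapsible.vab colv))
... | d , d≢v , abd = d∉vbc (covers (v≢b , b≢c , v≢c) vbc⊆link d∈link)
  where
  open Collapsible colv
  open Collapsible cola using () renaming (link⊆abc to link⊆xyz)
  v≢b = proj₂ (proj₂ (TriIn-distinct vab))
  b≢c = proj₁ (proj₂ (TriIn-distinct vbc))
  v≢c = proj₂ (proj₂ (TriIn-distinct vbc))
  vbc⊆link = link⊆xyz (TriIn-swap vab) , link⊆xyz (TriIn-rotate vab)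
           , link⊆xyz (TriIn-swap (TriIn-rotate vca))
  d∈link = link⊆xyz (TriIn-rotate (TriIn-swap abd))
  d∉vbc : ¬ d ∈ₜ tri v b c
  d∉vbc (inj₁ d≡v) = d≢v d≡v
  d∉vbc (inj₂ (inj₁ d≡b)) = proj₁ (proj₂ (TriIn-distinct abd)) (sym d≡b)
  d∉vbc (inj₂ (inj₂ refl)) = abc∉K abd

collapsible-∉-link : ∀ {K v a b c w x y z} → Boundaryless K → Collapsible K v a b c →
  Collapsible K w x y z → ¬ w ∈ₜ tri a b c
collapsible-∉-link bl colv colw (inj₁ refl) = link-vertex-not-collapsible bl colv colw
collapsible-∉-link bl colv colw (inj₂ (inj₁ refl)) =
  link-vertex-not-collapsible bl (Collapsible-rotate colv) colw
collapsible-∉-link bl colv colw (inj₂ (inj₂ refl)) =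
  link-vertex-not-collapsible bl (Collapsible-rotate (Collapsible-rotate colv)) colw

star-relabel : ∀ {K u a b c u′ a′ b′ c′ p q r} {f : ℕ → ℕ} →
  Collapsible K u a b c → Collapsible K u′ a′ b′ c′ → (∀ {s} → s ∈ₜ tri a b c → s ∈ₜ tri a′ b′ c′) →
  Injective _≡_ _≡_ f → f u ≡ u′ → (∀ {s} → s ∈ₜ tri a b c → f s ≡ s) →
  u ∈ₜ tri p q r → TriIn K p q r → TriIn K (f p) (f q) (f r)
star-relabel {K} {u} {f = f} colu colu′ link⊆link′ inj refl fixed u∈ pqr
  with other-corners (TriIn-distinct pqr) u∈
... | s , t , ust-distinct@(_ , s≢t , _) , ust-spans@(_ , s∈pqr , t∈pqr) =
  TriIn-transfer u′st (Distinct₃-map inj (TriIn-distinct pqr))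
    (∈ₜ-map f u∈ , subst (_∈ₜ _) (fixed s∈) (∈ₜ-map f s∈pqr) , subst (_∈ₜ _) (fixed t∈) (∈ₜ-map f t∈pqr))
  where
  ust : TriIn K u s t
  ust = TriIn-reorder pqr ust-distinct ust-spans
  s∈ = Collapsible.link⊆abc colu ust
  t∈ = Collapsible.link⊆abc colu (TriIn-rotate (TriIn-swap ust))
  open Collapsible colu′ using () renaming (vab to u′ab; vbc to u′bc; vca to u′ca)
  u′st = TriIn-rotate (TriIn-rotate
    (Sectors.link-edge u′ab u′bc u′ca (link⊆link′ s∈) (link⊆link′ t∈) s≢t))

TriIn-collapse-mono : ∀ {K v a b c x y z p q r} → (∀ {s} → s ∈ₜ tri a b c → s ∈ₜ tri x y z) →
  TriIn (collapse v a b c K) p q r → TriIn (collapse v x y z K) p q r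
TriIn-collapse-mono {K} {v} {a} {b} {c} {x} {y} {z} =
  TriIn-collapse-relabel {K} {K} {v} {a} {b} {c} {v} {x} {y} {z} (λ eq → eq) (λ pqr → pqr) refl

TriIn-collapse-comm : ∀ {K v a b c w x y z p q r} → ¬ v ∈ₜ tri x y z →
  TriIn (collapse w x y z (collapse v a b c K)) p q r →
  TriIn (collapse v a b c (collapse w x y z K)) p q r
TriIn-collapse-comm {K} {v} {a} {b} {c} {w} {x} {y} {z} v∉xyz pqr
  with TriIn-collapse⁻ {collapse v a b c K} {w} {x} {y} {z} pqr
... | inj₁ xyz⊇pqr =
  TriIn-collapse⁺ʳ {collapse w x y z K} {v} {a} {b} {c}
    (TriIn-collapse⁺ˡ {K} {w} {x} {y} {z} (TriIn-distinct pqr) xyz⊇pqr) (v∉xyz ∘ spans⇒⊆ xyz⊇pqr)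
... | inj₂ (pqr′ , w∉pqr) with TriIn-collapse⁻ {K} {v} {a} {b} {c} pqr′
...   | inj₁ abc⊇pqr = TriIn-collapse⁺ˡ {collapse w x y z K} {v} (TriIn-distinct pqr) abc⊇pqr
...   | inj₂ (pqr∈K , v∉pqr) =
  TriIn-collapse⁺ʳ {collapse w x y z K} {v} {a} {b} {c}
    (TriIn-collapse⁺ʳ {K} {w} {x} {y} {z} pqr∈K w∉pqr) v∉pqr

transpose : ℕ → ℕ → ℕ → ℕ
transpose v w n with n ≟ v | n ≟ w
... | yes _ | _ = w
... | no _ | yes _ = v
... | no _ | no _ = n

module _ {v w : ℕ} where

  transpose-v : transpose v w v ≡ w
  transpose-v with v ≟ v
  ... | yes _ = refl
  ... | no v≢v = ⊥-elim (v≢v refl)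

  transpose-fix : ∀ {n} → n ≢ v → n ≢ w → transpose v w n ≡ n
  transpose-fix {n} n≢v n≢w with n ≟ v | n ≟ w
  ... | yes n≡v | _ = ⊥-elim (n≢v n≡v)
  ... | no _ | yes n≡w = ⊥-elim (n≢w n≡w)
  ... | no _ | no _ = refl

module _ {v w : ℕ} (v≢w : v ≢ w) where

  transpose-w : transpose v w w ≡ v
  transpose-w with w ≟ v | w ≟ w
  ... | yes w≡v | _ = ⊥-elim (v≢w (sym w≡v))
  ... | no _ | yes _ = refl
  ... | no _ | no w≢w = ⊥-elim (w≢w refl)

  transpose-involutive : ∀ n → transpose v w (transpose v w n) ≡ n
  transpose-involutive n = by-cases (n ≟ v) (n ≟ w)
    where
    by-cases : Dec (n ≡ v) → Dec (n ≡ w) → transpose v w (transpose v w n) ≡ n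
    by-cases (yes refl) _ = trans (cong (transpose v w) (transpose-v {v} {w})) transpose-w
    by-cases (no n≢v) (yes refl) = trans (cong (transpose v w) transpose-w) (transpose-v {v} {w})
    by-cases (no n≢v) (no n≢w) =
      trans (cong (transpose v w) (transpose-fix {v} {w} n≢v n≢w)) (transpose-fix {v} {w} n≢v n≢w)

  transpose-↔ : ℕ ↔ ℕ
  transpose-↔ = mk↔ₛ′ (transpose v w) (transpose v w) transpose-involutive transpose-involutive

Collapsible-collapse : ∀ {K v a b c w x y z} → Collapsible K w x y z → v ≢ w → ¬ w ∈ₜ tri a b c →
  ¬ v ∈ₜ tri x y z → ¬ Spans (tri a b c) x y z → Collapsible (collapse v a b c K) w x y z
Collapsible-collapse {K} {v} {a} {b} {c} colw v≢w w∉abc v∉xyz xyz⊈abc = record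
  { vab = keep vab ; vbc = keep vbc ; vca = keep vca
  ; link⊆abc = λ wpq → Sum.[ (λ (w∈ , _) → ⊥-elim (w∉abc w∈)) , (λ (wpq′ , _) → link⊆abc wpq′) ]
                         (TriIn-collapse⁻ {K} {v} {a} {b} {c} wpq)
  ; abc∉K = λ xyz′ → Sum.[ xyz⊈abc , abc∉K ∘ proj₁ ] (TriIn-collapse⁻ {K} {v} {a} {b} {c} xyz′)
  }
  where
  open Collapsible colw
  keep : ∀ {p q} → TriIn K _ p q → TriIn (collapse v a b c K) _ p q
  keep wpq = TriIn-collapse⁺ʳ {K} {v} {a} {b} {c} wpq
    (∉ₜ v≢w (λ { refl → v∉xyz (link⊆abc wpq) })
            (λ { refl → v∉xyz (link⊆abc (TriIn-rotate (TriIn-swap wpq))) }))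

module LocalConfluence {K v a b c w x y z} (bl : Boundaryless K)
  (colv : Collapsible K v a b c) (colw : Collapsible K w x y z) where

  private
    open Collapsible
    w∉abc = collapsible-∉-link bl colv colw
    v∉xyz = collapsible-∉-link bl colw colv
    abc-distinct = Sectors.abc-distinct (vab colv) (vbc colv) (vca colv)
    xyz-distinct = Sectors.abc-distinct (vab colw) (vbc colw) (vca colw)

  same-vertex : v ≡ w → Iso (collapse v a b c K) (collapse w x y z K)
  same-vertex refl = Iso-pointwise (TriIn-collapse-mono {K} {v} (covers xyz-distinct xyz⊆abc))
                                   (TriIn-collapse-mono {K} {v} (spans⇒⊆ xyz⊆abc))
    where
    xyz⊆abc : Spans (tri a b c) x y z
    xyz⊆abc = link⊆abc colv (vab colw) , link⊆abc colv (vbc colw) , link⊆abc colv (vca colw)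

  -- Here v and w are two cone points over the same triangle a b c, so transposing them
  -- preserves K and exchanges the two collapses.
  swap : v ≢ w → Spans (tri a b c) x y z → Iso (collapse v a b c K) (collapse w x y z K)
  swap v≢w xyz⊆abc =
    mkIso (transpose-↔ v≢w)
      (TriIn-collapse-relabel {K} {K} {v} {a} {b} {c} {w} {x} {y} {z} τ-injective K-invariant
        (transpose-v {v} {w}) (λ s∈ → subst (_∈ₜ _) (sym (fix-abc s∈)) (abc⊆xyz s∈)))
      (TriIn-collapse-relabel {K} {K} {w} {x} {y} {z} {v} {a} {b} {c} τ-injective K-invariant
        (transpose-w v≢w) (λ s∈ → subst (_∈ₜ _) (sym (fix-xyz s∈)) (spans⇒⊆ xyz⊆abc s∈)))
    where
    τ = transpose v w
    τ-injective = Injection.injective (↔⇒↣ (transpose-↔ v≢w))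
    abc⊆xyz : ∀ {s} → s ∈ₜ tri a b c → s ∈ₜ tri x y z
    abc⊆xyz = covers xyz-distinct xyz⊆abc
    fix-abc : ∀ {s} → s ∈ₜ tri a b c → τ s ≡ s
    fix-abc s∈ = transpose-fix {v} {w} (λ { refl → Sectors.v∉abc (vab colv) (vbc colv) (vca colv) s∈ })
                                    (λ { refl → w∉abc s∈ })
    fix-xyz : ∀ {s} → s ∈ₜ tri x y z → τ s ≡ s
    fix-xyz = fix-abc ∘ spans⇒⊆ xyz⊆abc
    K-invariant : ∀ {p q r} → TriIn K p q r → TriIn K (τ p) (τ q) (τ r)
    K-invariant {p} {q} {r} pqr with ∈ₜ-dec v (tri p q r) | ∈ₜ-dec w (tri p q r)
    ... | yes v∈ | _ = star-relabel colv colw abc⊆xyz τ-injective (transpose-v {v} {w}) fix-abc v∈ pqr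
    ... | no _ | yes w∈ =
      star-relabel colw colv (spans⇒⊆ xyz⊆abc) τ-injective (transpose-w v≢w) fix-xyz w∈ pqr
    ... | no v∉ | no w∉ =
      TriIn-cong (sym (fixed inj₁)) (sym (fixed (inj₂ ∘ inj₁))) (sym (fixed (inj₂ ∘ inj₂))) pqr
      where
      fixed : ∀ {s} → (∀ {u} → u ≡ s → u ∈ₜ tri p q r) → τ s ≡ s
      fixed at = transpose-fix {v} {w} (v∉ ∘ at ∘ sym) (w∉ ∘ at ∘ sym)

  locally-confluent :
    Iso (collapse v a b c K) (collapse w x y z K)
    ⊎ (Collapsible (collapse v a b c K) w x y z × Collapsible (collapse w x y z K) v a b c
       × Iso (collapse w x y z (collapse v a b c K)) (collapse v a b c (collapse w x y z K)))
  locally-confluent with v ≟ w | Spans-dec (tri a b c) x y z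
  ... | yes v≡w | _ = inj₁ (same-vertex v≡w)
  ... | no v≢w | yes xyz⊆abc = inj₁ (swap v≢w xyz⊆abc)
  ... | no v≢w | no xyz⊈abc =
    inj₂ ( Collapsible-collapse colw v≢w w∉abc v∉xyz xyz⊈abc
         , Collapsible-collapse colv (≢-sym v≢w) v∉xyz w∉abc (xyz⊈abc ∘ spans-flip abc-distinct)
         , Iso-pointwise (TriIn-collapse-comm {K} {v} {a} {b} {c} {w} {x} {y} {z} v∉xyz)
                         (TriIn-collapse-comm {K} {w} {x} {y} {z} {v} {a} {b} {c} w∉abc) )

-- Decidability and termination of inverse T-moves

TriIn-dec : ∀ K p q r → Dec (TriIn K p q r)
TriIn-dec K p q r =
  ¬? (p ≟ q) ×-dec ¬? (q ≟ r) ×-dec ¬? (p ≟ r) ×-dec Any.any? (λ t → Spans-dec t p q r) K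

InvTAt : Complex → ℕ → ℕ → ℕ → ℕ → Set
InvTAt K v a b c = valence v K ≡ 3 × TriIn K v a b × TriIn K v b c × TriIn K v c a × ¬ TriIn K a b c

InvTAt-dec : ∀ K v a b c → Dec (InvTAt K v a b c)
InvTAt-dec K v a b c = valence v K ≟ 3 ×-dec TriIn-dec K v a b ×-dec TriIn-dec K v b c
                       ×-dec TriIn-dec K v c a ×-dec ¬? (TriIn-dec K a b c)

vertices : Complex → List ℕ
vertices [] = []
vertices (tri p q r ∷ K) = p ∷ q ∷ r ∷ vertices K

∈ₜ⇒∈vertices : ∀ {K t w} → t ∈ K → w ∈ₜ t → w ∈ vertices K
∈ₜ⇒∈vertices {_ ∷ _} (here refl) = Sum.[ here , Sum.[ there ∘ here , there ∘ there ∘ here ] ]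
∈ₜ⇒∈vertices {_ ∷ _} (there t∈) = there ∘ there ∘ there ∘ ∈ₜ⇒∈vertices t∈

TriIn⇒∈vertices : ∀ {K p q r} → TriIn K p q r → p ∈ vertices K × q ∈ vertices K × r ∈ vertices K
TriIn⇒∈vertices (_ , _ , _ , pqr∈) =
  let t , t∈ , p∈ , q∈ , r∈ = find pqr∈
  in ∈ₜ⇒∈vertices t∈ p∈ , ∈ₜ⇒∈vertices t∈ q∈ , ∈ₜ⇒∈vertices t∈ r∈

InvT-dec : ∀ K → Dec (∃ (InvT K))
InvT-dec K = map′ found witness (any? λ v → any? λ a → any? λ b → any? λ c → InvTAt-dec K v a b c)
  where
  any? : ∀ {P : ℕ → Set} → (∀ u → Dec (P u)) → Dec (Any P (vertices K))
  any? P? = Any.any? P? (vertices K)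
  Candidate : Set
  Candidate = Any (λ v → Any (λ a → Any (λ b → Any (λ c → InvTAt K v a b c)
                (vertices K)) (vertices K)) (vertices K)) (vertices K)
  found : Candidate → ∃ (InvT K)
  found anyv =
    let v , anya = satisfied anyv
        a , anyb = satisfied anya
        b , anyc = satisfied anyb
        c , val , vab , vbc , vca , abc∉K = satisfied anyc
    in -, v , a , b , c , val , vab , vbc , vca , abc∉K , refl
  witness : ∃ (InvT K) → Candidate
  witness (_ , v , a , b , c , val , vab , vbc , vca , abc∉K , _) =
    let v∈ , a∈ , b∈ = TriIn⇒∈vertices vab
    in lose v∈ (lose a∈ (lose b∈ (lose (proj₂ (proj₂ (TriIn⇒∈vertices vbc)))
         (val , vab , vbc , vca , abc∉K))))

InvT-shrinks : ∀ {K K′} → InvT K K′ → length K′ < length K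
InvT-shrinks {K} (v , a , b , c , val , _ , _ , _ , _ , refl) = collapse-shrinks {v} {a} {b} {c} {K} val

InvT-terminating : StronglyNormalizing InvT
InvT-terminating = Subrelation.wellFounded InvT-shrinks (On.wellFounded length <-wellFounded)

InvT-preserves-Boundaryless : ∀ {K K′} → Boundaryless K → InvT K K′ → Boundaryless K′
InvT-preserves-Boundaryless bl step with InvT⇒Collapsible step
... | _ , _ , _ , _ , col , refl = Boundaryless-collapse bl col

InvT-simulate : ∀ {K K′ L} → Boundaryless K → Boundaryless L → Iso K L → InvT K K′ →
  ∃[ L′ ] (InvT L L′ × Iso K′ L′)
InvT-simulate _ blL iso step with InvT⇒Collapsible step
... | _ , _ , _ , _ , col , refl = -, Collapsible⇒InvT blL (Collapsible-Iso iso col) , collapse-Iso iso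

InvT-locally-confluent : ∀ {K K₁ K₂} → Boundaryless K → InvT K K₁ → InvT K K₂ →
  Iso K₁ K₂ ⊎ ∃₂ λ K₁′ K₂′ → InvT K₁ K₁′ × InvT K₂ K₂′ × Iso K₁′ K₂′
InvT-locally-confluent bl step₁ step₂ with InvT⇒Collapsible step₁ | InvT⇒Collapsible step₂
... | _ , _ , _ , _ , col₁ , refl | _ , _ , _ , _ , col₂ , refl
  with LocalConfluence.locally-confluent bl col₁ col₂
...   | inj₁ iso = inj₁ iso
...   | inj₂ (col₂′ , col₁′ , iso) =
  inj₂ (-, -, Collapsible⇒InvT (Boundaryless-collapse bl col₁) col₂′
            , Collapsible⇒InvT (Boundaryless-collapse bl col₂) col₁′ , iso)

open NewmanModulo InvT Iso-isEquivalence Boundaryless InvT-terminating InvT-dec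
  InvT-preserves-Boundaryless InvT-simulate InvT-locally-confluent

theorem1p5 : (T : Complex) → ClosedSurface T →
    (∃[ R ] Root T R) × (∀ R R′ → Root T R → Root T R′ → Iso R R′)
theorem1p5 T closed = normalise T , λ _ _ → normalForm-unique (ClosedSurface⇒Boundaryless closed)
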